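{- If $G$ is a triangle-free graph, then $W_{def}(G)\leq |V(G)|+def(G)-1$.
   Context: All graphs are finite, undirected, without loops or multiple edges. A proper $t$-edge-coloring of $G$ is a map $\alpha:E(G)\to\{1,\ldots,t\}$ such that all $t$ colors are used and adjacent edges receive different colors. The spectrum $S(v,\alpha)$ of a vertex $v$ is the set of colors on edges incident to $v$. For a finite set $A$ of integers, $def(A)=\max A-\min A-|A|+1$ ($def(\emptyset)=0$). Define $def(v,\alpha)=def(S(v,\alpha))$, $def(G,\alpha)=\sum_{v\in V(G)}def(v,\alpha)$, and $def(G)=\min_\alpha def(G,\alpha)$ over all proper edge-colorings $\alpha$ of $G$. $W_{def}(G)$ is the largest $t$ such that $G$ has a proper $t$-edge-coloring $\alpha$ with $def(G,\alpha)=def(G)$. -}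

module Defs where

open import Data.Bool using (Bool; true; false; T)
open import Data.Nat using (ℕ; zero; suc; _+_; _∸_; _≤_; _⊔_; _⊓_)
open import Data.Nat.Properties using (_≟_)
open import Data.Fin using (Fin)
open import Data.Nat.ListAction using (sum)
open import Data.List using (List; []; _∷_; map; foldr; length; allFin; filterᵇ; deduplicate)
open import Data.Product using (_×_; ∃; ∃-syntax)
open import Relation.Binary.PropositionalEquality using (_≡_; _≢_)
open import Relation.Nullary using (¬_)

record Graph (n : ℕ) : Set where
  field
    adj    : Fin n → Fin n → Bool
    sym    : ∀ u v → adj u v ≡ adj v u
    irrefl : ∀ v → adj v v ≡ false
open Graph public

Adj : ∀ {n} → Graph n → Fin n → Fin n → Set
Adj G u v = T (adj G u v)

TriangleFree : ∀ {n} → Graph n → Set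
TriangleFree {n} G = ∀ (u v w : Fin n) → ¬ (Adj G u v × Adj G v w × Adj G u w)

-- An edge-colouring is a function giving a colour to each ordered pair;
-- only its values on edges matter, and it must be symmetric on edges.
Colouring : ℕ → Set
Colouring n = Fin n → Fin n → ℕ

Proper : ∀ {n} → Graph n → Colouring n → Set
Proper {n} G c =
  (∀ u v → Adj G u v → c u v ≡ c v u) ×
  (∀ v u w → Adj G v u → Adj G v w → u ≢ w → c v u ≢ c v w)

ProperTColouring : ∀ {n} → Graph n → ℕ → Colouring n → Set
ProperTColouring {n} G t c =
  Proper G c ×
  (∀ u v → Adj G u v → 1 ≤ c u v × c u v ≤ t) ×
  (∀ k → 1 ≤ k → k ≤ t → ∃[ u ] ∃[ v ] (Adj G u v × c u v ≡ k))

ProperEdgeColouring : ∀ {n} → Graph n → Colouring n → Set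
ProperEdgeColouring G c = ∃[ t ] ProperTColouring G t c

spectrumList : ∀ {n} → Graph n → Colouring n → Fin n → List ℕ
spectrumList {n} G c v = map (c v) (filterᵇ (adj G v) (allFin n))

maxL : List ℕ → ℕ
maxL [] = 0
maxL (x ∷ xs) = foldr _⊔_ x xs

minL : List ℕ → ℕ
minL [] = 0
minL (x ∷ xs) = foldr _⊓_ x xs

-- Since |A| ≤ max A − min A + 1
-- for nonempty A, the truncated subtraction below is exact.
defSet : List ℕ → ℕ
defSet [] = 0
defSet A@(_ ∷ _) = (maxL A + 1) ∸ (minL A + length (deduplicate _≟_ A))

defV : ∀ {n} → Graph n → Colouring n → Fin n → ℕ
defV G c v = defSet (spectrumList G c v)

defG : ∀ {n} → Graph n → Colouring n → ℕ
defG {n} G c = sum (map (defV G c) (allFin n))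

AttainsDef : ∀ {n} → Graph n → Colouring n → Set
AttainsDef {n} G c = ∀ (c' : Colouring n) → ProperEdgeColouring G c' → defG G c ≤ defG G c'

-- In a proper colouring the deg v colours at a vertex v are distinct, so
-- max S(v) + 1 ≤ min S(v) + deg v + def(v); more precisely, at least
-- max S(v) − c − def(v) of them exceed any colour c at v.
-- Grow breadth-first balls B around a vertex u and charge a vertex v entering B to its
-- neighbour m in B with the largest colour α(vm): the colours at v above α(vm) lead out of B,
-- and triangle-freeness separates those neighbours of v from the neighbours of m. This keeps
-- max S(v) + 2 ≤ min S(u) + |B ∪ N(v)| + def(B) for v ∈ B, and so on the component K of u,
-- max S(v) + 2 ≤ min S(u) + |K| + def(K).
-- Finally the colours 1, …, t are covered component by component: the component of an edge of
-- the least colour s pays for s, …, b, where b is the largest colour it meets, and the rest of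
-- the graph for b + 1, …, t. Summing gives t + 2 ≤ 1 + n + def(G, α).

module Submission where

open import Defs hiding (sym)
open import Data.Bool using (Bool; true; false; T; not; _∧_; _∨_; if_then_else_)
open import Data.Bool.Properties using (T?; T-∧; T-∨)
open import Data.Empty using (⊥-elim)
open import Data.Fin using (Fin; zero; suc)
open import Data.Fin.Properties using (any?; suc-injective; 0≢1+n) renaming (_≟_ to _≟ᶠ_)
open import Data.List using (List; _∷_; filter; map; length; tabulate; allFin; filterᵇ; deduplicate)
open import Data.List.Properties using (length-map; length-deduplicate; foldr-preservesᵒ)
open import Data.List.Membership.Propositional using () renaming (_∈_ to _∈ₗ_)
open import Data.List.Membership.Propositional.Properties using (∈-map⁺; ∈-filter⁺; ∈-allFin)
open import Data.List.Relation.Unary.Any using (Any; here; there)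
import Data.List.Relation.Unary.Any as Any
import Data.List.Relation.Unary.All as All
open import Data.List.Relation.Unary.All.Properties using (all-filter)
open import Data.List.Extrema.Nat using (argmax; argmax-all; f[xs]≤f[argmax])
open import Data.Nat using (ℕ; zero; suc; _+_; _∸_; _≤_; _<_; z≤n; s≤s)
open import Data.Nat.Tactic.RingSolver using (solve-∀)
open import Data.Nat.ListAction using (sum)
open import Data.Nat.Properties hiding (0≢1+n; suc-injective)
open import Data.Product using (_×_; _,_; proj₁; proj₂; ∃-syntax)
open import Data.Sum using (_⊎_; inj₁; inj₂; [_,_]′)
import Data.Sum
open import Function using (_∘_; id; Equivalence)
open import Relation.Binary.PropositionalEquality using (_≡_; refl; sym; trans; cong; cong₂; subst)
open import Relation.Nullary using (¬_; Dec; yes; no)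
open import Relation.Nullary.Decidable
  using (map′; ⌊_⌋; toWitness; fromWitness; _×-dec_; ¬?; decidable-stable)

open import Algebra.Properties.CommutativeSemigroup +-commutativeSemigroup using (interchange)

private
  variable
    n : ℕ

∑ : (Fin n → ℕ) → ℕ
∑ {zero}  f = 0
∑ {suc n} f = f zero + ∑ (f ∘ suc)

∑-mono-≤ : {f g : Fin n → ℕ} → (∀ i → f i ≤ g i) → ∑ f ≤ ∑ g
∑-mono-≤ {zero}  _   = z≤n
∑-mono-≤ {suc n} f≤g = +-mono-≤ (f≤g zero) (∑-mono-≤ (f≤g ∘ suc))

∑-distrib-+ : (f g : Fin n → ℕ) → ∑ (λ i → f i + g i) ≡ ∑ f + ∑ g
∑-distrib-+ {zero}  f g = refl
∑-distrib-+ {suc n} f g =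
  trans (cong (f zero + g zero +_) (∑-distrib-+ (f ∘ suc) (g ∘ suc)))
        (interchange (f zero) (g zero) (∑ (f ∘ suc)) (∑ (g ∘ suc)))

∑-zero : {f : Fin n → ℕ} → (∀ i → f i ≡ 0) → ∑ f ≡ 0
∑-zero {zero}  _   = refl
∑-zero {suc n} f≡0 = cong₂ _+_ (f≡0 zero) (∑-zero (f≡0 ∘ suc))

term-≤-∑ : (f : Fin n → ℕ) (i : Fin n) → f i ≤ ∑ f
term-≤-∑ f zero    = m≤m+n (f zero) _
term-≤-∑ f (suc i) = ≤-trans (term-≤-∑ (f ∘ suc) i) (m≤n+m _ (f zero))

∑-1 : ∀ n → ∑ {n} (λ _ → 1) ≡ n
∑-1 zero    = refl
∑-1 (suc n) = cong suc (∑-1 n)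

VertexSet : ℕ → Set
VertexSet n = Fin n → Bool

private
  variable
    u v w : Fin n
    X Y Z : VertexSet n

infix 4 _∈_ _∉_ _⊆_
infixr 6 _∩_
infixr 5 _∪_

-- A record rather than T (X w), so that X can be inferred from a membership proof.
record _∈_ (w : Fin n) (X : VertexSet n) : Set where
  constructor mk∈
  field T-∈ : T (X w)
open _∈_

_∉_ : Fin n → VertexSet n → Set
w ∉ X = ¬ w ∈ X

_⊆_ : VertexSet n → VertexSet n → Set
X ⊆ Y = ∀ {w} → w ∈ X → w ∈ Y

∈? : {X : VertexSet n} {w : Fin n} → Dec (w ∈ X)
∈? {X = X} {w} = map′ mk∈ T-∈ (T? (X w))

private

  T-not⁺ : ∀ {b} → ¬ T b → T (not b)
  T-not⁺ {true}  ¬b = ¬b _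
  T-not⁺ {false} _  = _

  T-not⁻ : ∀ {b} → T (not b) → ¬ T b
  T-not⁻ {false} _ ()

-- Opaque, so that unification treats the set operations as rigid and infers their arguments.
opaque

  _∩_ : VertexSet n → VertexSet n → VertexSet n
  (X ∩ Y) w = X w ∧ Y w

  _∪_ : VertexSet n → VertexSet n → VertexSet n
  (X ∪ Y) w = X w ∨ Y w

  ∁ : VertexSet n → VertexSet n
  ∁ X w = not (X w)

  ⟦_⟧ : {P : Fin n → Set} → (∀ w → Dec (P w)) → VertexSet n
  ⟦ P? ⟧ w = ⌊ P? w ⌋

  ∈-∩⁺ : w ∈ X → w ∈ Y → w ∈ X ∩ Y
  ∈-∩⁺ (mk∈ w∈X) (mk∈ w∈Y) = mk∈ (Equivalence.from T-∧ (w∈X , w∈Y))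

  ∈-∩⁻ : w ∈ X ∩ Y → w ∈ X × w ∈ Y
  ∈-∩⁻ (mk∈ w∈X∩Y) = let w∈X , w∈Y = Equivalence.to T-∧ w∈X∩Y in mk∈ w∈X , mk∈ w∈Y

  ∈-∪⁺ : w ∈ X ⊎ w ∈ Y → w ∈ X ∪ Y
  ∈-∪⁺ w∈X⊎Y = mk∈ (Equivalence.from T-∨ (Data.Sum.map T-∈ T-∈ w∈X⊎Y))

  ∈-∪⁻ : w ∈ X ∪ Y → w ∈ X ⊎ w ∈ Y
  ∈-∪⁻ (mk∈ w∈X∪Y) = Data.Sum.map mk∈ mk∈ (Equivalence.to T-∨ w∈X∪Y)

  ∈-∁⁺ : w ∉ X → w ∈ ∁ X
  ∈-∁⁺ w∉X = mk∈ (T-not⁺ (λ w∈X → w∉X (mk∈ w∈X)))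

  ∈-∁⁻ : w ∈ ∁ X → w ∉ X
  ∈-∁⁻ (mk∈ w∈∁X) (mk∈ w∈X) = T-not⁻ w∈∁X w∈X

  ∈-⟦⟧⁺ : {P : Fin n → Set} {P? : ∀ w → Dec (P w)} → P w → w ∈ ⟦ P? ⟧
  ∈-⟦⟧⁺ Pw = mk∈ (fromWitness Pw)

  ∈-⟦⟧⁻ : {P : Fin n → Set} {P? : ∀ w → Dec (P w)} → w ∈ ⟦ P? ⟧ → P w
  ∈-⟦⟧⁻ (mk∈ Pw) = toWitness Pw

｛_｝ : Fin n → VertexSet n
｛ v ｝ = ⟦ _≟ᶠ v ⟧

full : VertexSet n
full _ = true

∈-｛｝⁺ : (v : Fin n) → v ∈ ｛ v ｝
∈-｛｝⁺ v = ∈-⟦⟧⁺ refl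

∈-｛｝⁻ : {v w : Fin n} → w ∈ ｛ v ｝ → w ≡ v
∈-｛｝⁻ = ∈-⟦⟧⁻

∈-full : {w : Fin n} → w ∈ full
∈-full = mk∈ _

restrict : VertexSet n → (Fin n → ℕ) → Fin n → ℕ
restrict X f w = if X w then f w else 0

∑∈ : VertexSet n → (Fin n → ℕ) → ℕ
∑∈ X f = ∑ (restrict X f)

∣_∣ : VertexSet n → ℕ
∣ X ∣ = ∑∈ X (λ _ → 1)

private

  if-true : ∀ {a} x → T a → (if a then x else 0) ≡ x
  if-true {true} x _ = refl

  if-false : ∀ {a} x → ¬ T a → (if a then x else 0) ≡ 0
  if-false {true}  x ¬a = ⊥-elim (¬a _)
  if-false {false} x _  = refl

  if-mono : ∀ {a b} x → (T a → T b) → (if a then x else 0) ≤ (if b then x else 0)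
  if-mono {false}         x _   = z≤n
  if-mono {true} {true}   x _   = ≤-refl
  if-mono {true} {false}  x a⇒b = ⊥-elim (a⇒b _)

  if-cover : ∀ {a b c} x → (T a → T b ⊎ T c) →
             (if a then x else 0) ≤ (if b then x else 0) + (if c then x else 0)
  if-cover {false}                x _ = z≤n
  if-cover {true} {true}          x _ = m≤m+n x _
  if-cover {true} {false} {true}  x _ = ≤-refl
  if-cover {true} {false} {false} x a⇒b∨c with a⇒b∨c _
  ... | inj₁ ()
  ... | inj₂ ()

  if-disjoint : ∀ {a b c} x → (T a → ¬ T b) → (T a → T c) → (T b → T c) →
                (if a then x else 0) + (if b then x else 0) ≤ (if c then x else 0)
  if-disjoint {false} {false} x _ _ _     = z≤n
  if-disjoint {false} {true}  x _ _ b⇒c   = if-mono x b⇒c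
  if-disjoint {true}  {false} {c} x _ a⇒c _ =
    subst (_≤ (if c then x else 0)) (sym (+-identityʳ x)) (if-mono x a⇒c)
  if-disjoint {true}  {true}  x a⇒¬b _ _  = ⊥-elim (a⇒¬b _ _)

module _ {f : Fin n → ℕ} where

  ∑∈-mono-⊆ : {X Y : VertexSet n} → X ⊆ Y → ∑∈ X f ≤ ∑∈ Y f
  ∑∈-mono-⊆ {X} {Y} X⊆Y = ∑-mono-≤ λ w →
    if-mono {X w} {Y w} (f w) λ w∈X → T-∈ (X⊆Y (mk∈ w∈X))

  ∑∈-cover : {X Y Z : VertexSet n} → Z ⊆ X ∪ Y → ∑∈ Z f ≤ ∑∈ X f + ∑∈ Y f
  ∑∈-cover {X} {Y} {Z} Z⊆X∪Y = ≤-trans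
    (∑-mono-≤ λ w → if-cover {Z w} {X w} {Y w} (f w) λ w∈Z →
      Data.Sum.map T-∈ T-∈ (∈-∪⁻ (Z⊆X∪Y (mk∈ w∈Z))))
    (≤-reflexive (∑-distrib-+ (restrict X f) (restrict Y f)))

  ∑∈-disjoint : {X Y Z : VertexSet n} → (∀ {w} → w ∈ X → w ∉ Y) → X ⊆ Z → Y ⊆ Z →
                ∑∈ X f + ∑∈ Y f ≤ ∑∈ Z f
  ∑∈-disjoint {X} {Y} {Z} disjoint X⊆Z Y⊆Z = ≤-trans
    (≤-reflexive (sym (∑-distrib-+ (restrict X f) (restrict Y f))))
    (∑-mono-≤ λ w → if-disjoint {X w} {Y w} {Z w} (f w)
      (λ w∈X w∈Y → disjoint (mk∈ w∈X) (mk∈ w∈Y))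
      (λ w∈X → T-∈ (X⊆Z (mk∈ w∈X)))
      (λ w∈Y → T-∈ (Y⊆Z (mk∈ w∈Y))))

  ∑∈-≥ : {X : VertexSet n} {v : Fin n} → v ∈ X → f v ≤ ∑∈ X f
  ∑∈-≥ {X} {v} (mk∈ v∈X) = subst (_≤ ∑∈ X f) (if-true (f v) v∈X) (term-≤-∑ _ v)

  ∑∈-empty : {X : VertexSet n} → (∀ {w} → w ∉ X) → ∑∈ X f ≡ 0
  ∑∈-empty {X} empty = ∑-zero λ w → if-false {X w} (f w) λ w∈X → empty (mk∈ w∈X)

∑∈-split-∁ : {f : Fin n → ℕ} → Y ⊆ X → ∑∈ Y f + ∑∈ (X ∩ ∁ Y) f ≤ ∑∈ X f
∑∈-split-∁ Y⊆X = ∑∈-disjoint (λ w∈Y w∈X∖Y → ∈-∁⁻ (proj₂ (∈-∩⁻ w∈X∖Y)) w∈Y)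
                             Y⊆X (λ w∈X∖Y → proj₁ (∈-∩⁻ w∈X∖Y))

∣∣≤n : (X : VertexSet n) → ∣ X ∣ ≤ n
∣∣≤n {n} X = ≤-trans (∑∈-mono-⊆ {X = X} {full} (λ _ → ∈-full)) (≤-reflexive (∑-1 n))

∣∣≤1 : {X : VertexSet n} → (∀ {v w} → v ∈ X → w ∈ X → v ≡ w) → ∣ X ∣ ≤ 1
∣∣≤1 {zero}          _      = z≤n
∣∣≤1 {suc n} {X} unique with X zero in eq
... | true  = ≤-reflexive (cong suc (∑∈-empty λ {w} w∈X →
  0≢1+n (unique {zero} {suc w} (mk∈ (subst T (sym eq) _)) (mk∈ (T-∈ w∈X)))))
... | false = ∣∣≤1 λ {v} {w} v∈X w∈X →
  suc-injective (unique {suc v} {suc w} (mk∈ (T-∈ v∈X)) (mk∈ (T-∈ w∈X)))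

∃-maximiser : (f : Fin n → ℕ) → u ∈ X → ∃[ m ] (m ∈ X × (∀ {w} → w ∈ X → f w ≤ f m))
∃-maximiser {n} {u} {X} f u∈X =
    argmax f u members
  , argmax-all f u∈X (all-filter _∈X? (allFin n))
  , λ {w} w∈X → All.lookup (f[xs]≤f[argmax] u members) (∈-filter⁺ _∈X? (∈-allFin w) w∈X)
  where
  _∈X? : ∀ w → Dec (w ∈ X)
  w ∈X? = ∈?

  members : List (Fin n)
  members = filter _∈X? (allFin n)

below : (Fin n → ℕ) → ℕ → VertexSet n
below f h = ⟦ (λ w → f w <? h) ⟧

above : (Fin n → ℕ) → ℕ → VertexSet n
above f c = ⟦ (λ w → c <? f w) ⟧

∣∩below∣-≤ : (f : Fin n → ℕ) {X : VertexSet n} {lo : ℕ} →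
             (∀ {w} → w ∈ X → lo ≤ f w) →
             (∀ {v w} → v ∈ X → w ∈ X → f v ≡ f w → v ≡ w) →
             ∀ k → ∣ X ∩ below f (lo + k) ∣ ≤ k
∣∩below∣-≤ f {X} {lo} lo≤f injective zero = ≤-reflexive (∑∈-empty λ w∈ →
  let w∈X , fw<lo+0 = ∈-∩⁻ w∈ in
  <⇒≱ (subst (f _ <_) (+-identityʳ lo) (∈-⟦⟧⁻ fw<lo+0)) (lo≤f w∈X))
∣∩below∣-≤ {n} f {X} {lo} lo≤f injective (suc k) = begin
  ∣ X ∩ below f (lo + suc k) ∣        ≤⟨ ∑∈-cover split ⟩
  ∣ X ∩ below f (lo + k) ∣ + ∣ X ∩ hit ∣ ≤⟨ +-mono-≤ (∣∩below∣-≤ f lo≤f injective k) (∣∣≤1 unique) ⟩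
  k + 1                                  ≡⟨ +-comm k 1 ⟩
  suc k                                  ∎
  where
  open ≤-Reasoning
  hit : VertexSet n
  hit = ⟦ (λ w → f w ≟ lo + k) ⟧

  split : X ∩ below f (lo + suc k) ⊆ X ∩ below f (lo + k) ∪ X ∩ hit
  split {w} w∈ with ∈-∩⁻ w∈
  ... | w∈X , fw< with m<1+n⇒m<n∨m≡n (subst (f w <_) (+-suc lo k) (∈-⟦⟧⁻ fw<))
  ... | inj₁ fw<lo+k = ∈-∪⁺ (inj₁ (∈-∩⁺ w∈X (∈-⟦⟧⁺ fw<lo+k)))
  ... | inj₂ fw≡lo+k = ∈-∪⁺ (inj₂ (∈-∩⁺ w∈X (∈-⟦⟧⁺ fw≡lo+k)))

  unique : ∀ {v w} → v ∈ X ∩ hit → w ∈ X ∩ hit → v ≡ w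
  unique v∈ w∈ with ∈-∩⁻ v∈ | ∈-∩⁻ w∈
  ... | v∈X , fv≡ | w∈X , fw≡ = injective v∈X w∈X (trans (∈-⟦⟧⁻ fv≡) (sym (∈-⟦⟧⁻ fw≡)))

length-filterᵇ-tabulate : {A : Set} (p : A → Bool) (g : Fin n → A) →
                          length (filterᵇ p (tabulate g)) ≡ ∣ p ∘ g ∣
length-filterᵇ-tabulate {zero}  p g = refl
length-filterᵇ-tabulate {suc n} p g with p (g zero)
... | true  = cong suc (length-filterᵇ-tabulate p (g ∘ suc))
... | false = length-filterᵇ-tabulate p (g ∘ suc)

sum-map-tabulate : {A : Set} (f : A → ℕ) (g : Fin n → A) → sum (map f (tabulate g)) ≡ ∑ (f ∘ g)
sum-map-tabulate {zero}  f g = refl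
sum-map-tabulate {suc n} f g = cong (f (g zero) +_) (sum-map-tabulate f (g ∘ suc))

minL-≤ : ∀ {y xs} → y ∈ₗ xs → minL xs ≤ y
minL-≤ {y} {x ∷ xs} y∈ = foldr-preservesᵒ {P = _≤ y}
  (λ a b → [ m≤n⇒m⊓o≤n b , m≤n⇒o⊓m≤n a ]′) x xs (lower y∈)
  where
  lower : y ∈ₗ x ∷ xs → x ≤ y ⊎ Any (_≤ y) xs
  lower (here y≡x)    = inj₁ (≤-reflexive (sym y≡x))
  lower (there y∈xs) = inj₂ (Any.map (λ y≡z → ≤-reflexive (sym y≡z)) y∈xs)

≤-maxL : ∀ {y xs} → y ∈ₗ xs → y ≤ maxL xs
≤-maxL {y} {x ∷ xs} y∈ = foldr-preservesᵒ {P = y ≤_}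
  (λ a b → [ m≤n⇒m≤n⊔o b , m≤n⇒m≤o⊔n a ]′) x xs (upper y∈)
  where
  upper : y ∈ₗ x ∷ xs → y ≤ x ⊎ Any (y ≤_) xs
  upper (here y≡x)    = inj₁ (≤-reflexive y≡x)
  upper (there y∈xs) = inj₂ (Any.map ≤-reflexive y∈xs)

-- The membership hypothesis only rules out the empty list, whose def is 0 by convention.
defSet-bound : ∀ {y xs} → y ∈ₗ xs → maxL xs + 1 ≤ minL xs + length xs + defSet xs
defSet-bound {xs = xs@(_ ∷ _)} _ = begin
  maxL xs + 1                                       ≤⟨ m≤n+m∸n (maxL xs + 1) (minL xs + distinct) ⟩
  minL xs + distinct + defSet xs                    ≤⟨ +-monoˡ-≤ (defSet xs) (+-monoʳ-≤ (minL xs)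
                                                          (length-deduplicate _≟_ xs)) ⟩
  minL xs + length xs + defSet xs                   ∎
  where
  open ≤-Reasoning
  distinct : ℕ
  distinct = length (deduplicate _≟_ xs)

join-interval-bounds : ∀ {t b s x d k e x′ d′} →
  t + 2 ≤ suc b + x′ + d′ → b + 2 ≤ s + k + e → k + x′ ≤ x → e + d′ ≤ d → t + 2 ≤ s + x + d
join-interval-bounds {t} {b} {s} {x} {d} {k} {e} {x′} {d′} upper lower kx ed =
  +-cancelˡ-≤ (suc b) _ _ (begin
    suc b + (t + 2)                    ≤⟨ n≤1+n _ ⟩
    suc (suc b + (t + 2))              ≡⟨ rearrange₁ b t ⟩
    t + 2 + (b + 2)                    ≤⟨ +-mono-≤ upper lower ⟩
    suc b + x′ + d′ + (s + k + e)      ≡⟨ rearrange₂ b x′ d′ s k e ⟩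
    suc b + (s + (k + x′) + (e + d′))  ≤⟨ +-monoʳ-≤ (suc b) (+-mono-≤ (+-monoʳ-≤ s kx) ed) ⟩
    suc b + (s + x + d)                ∎)
  where
  open ≤-Reasoning
  rearrange₁ : ∀ b t → suc (suc b + (t + 2)) ≡ t + 2 + (b + 2)
  rearrange₁ = solve-∀

  rearrange₂ : ∀ b x′ d′ s k e → suc b + x′ + d′ + (s + k + e) ≡ suc b + (s + (k + x′) + (e + d′))
  rearrange₂ = solve-∀

module _ (G : Graph n) where

  Closed : VertexSet n → Set
  Closed X = ∀ {u w} → u ∈ X → Adj G u w → w ∈ X

  ∩∁-closed : Closed X → Closed Y → Closed (X ∩ ∁ Y)
  ∩∁-closed X-closed Y-closed {u} {w} u∈ uw with ∈-∩⁻ u∈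
  ... | u∈X , u∉Y = ∈-∩⁺ (X-closed u∈X uw)
    (∈-∁⁺ λ w∈Y → ∈-∁⁻ u∉Y (Y-closed w∈Y (subst T (Graph.sym G u w) uw)))

  closed-or-escapes : (X : VertexSet n) → Closed X ⊎ ∃[ u ] ∃[ w ] (u ∈ X × Adj G u w × w ∉ X)
  closed-or-escapes X with any? (λ u → any? λ w → ∈? ×-dec T? (adj G u w) ×-dec ¬? ∈?)
  ... | yes (u , w , u∈X , uw , w∉X) = inj₂ (u , w , u∈X , uw , w∉X)
  ... | no ¬escape = inj₁ λ {u} {w} u∈X uw →
    decidable-stable ∈? λ w∉X → ¬escape (u , w , u∈X , uw , w∉X)

  N[_] : VertexSet n → VertexSet n
  N[ X ] = ⟦ (λ w → any? λ u → ∈? {X = X} {u} ×-dec T? (adj G u w)) ⟧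

  ∈-N[]⁺ : {X : VertexSet n} {u w : Fin n} → u ∈ X → Adj G u w → w ∈ N[ X ]
  ∈-N[]⁺ {u = u} u∈X uw = ∈-⟦⟧⁺ (u , u∈X , uw)

  ∈-N[]⁻ : {X : VertexSet n} {w : Fin n} → w ∈ N[ X ] → ∃[ u ] (u ∈ X × Adj G u w)
  ∈-N[]⁻ = ∈-⟦⟧⁻

  ball : Fin n → ℕ → VertexSet n
  ball u zero    = ｛ u ｝
  ball u (suc j) = ball u j ∪ N[ ball u j ]

  module _ {u : Fin n} where

    centre∈ball : ∀ j → u ∈ ball u j
    centre∈ball zero    = ∈-｛｝⁺ u
    centre∈ball (suc j) = ∈-∪⁺ (inj₁ (centre∈ball j))

    ball-⊆-suc : ∀ j → ball u j ⊆ ball u (suc j)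
    ball-⊆-suc j w∈B = ∈-∪⁺ (inj₁ w∈B)

    ball-⊆-closed : {X : VertexSet n} → Closed X → u ∈ X → ∀ j → ball u j ⊆ X
    ball-⊆-closed _      u∈X zero    w∈B rewrite ∈-｛｝⁻ w∈B = u∈X
    ball-⊆-closed closed u∈X (suc j) w∈B with ∈-∪⁻ w∈B
    ... | inj₁ w∈Bj = ball-⊆-closed closed u∈X j w∈Bj
    ... | inj₂ w∈N  = let v , v∈Bj , vw = ∈-N[]⁻ w∈N in
                      closed (ball-⊆-closed closed u∈X j v∈Bj) vw

    closed-or-growing : ∀ j → (∃[ J ] Closed (ball u J)) ⊎ (suc j ≤ ∣ ball u j ∣)
    closed-or-growing zero = inj₂ (∑∈-≥ (∈-｛｝⁺ u))
    closed-or-growing (suc j) with closed-or-growing j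
    ... | inj₁ closed = inj₁ closed
    ... | inj₂ size with closed-or-escapes (ball u j)
    ... | inj₁ closed = inj₁ (j , closed)
    ... | inj₂ (v , w , v∈B , vw , w∉B) = inj₂ (subst (_≤ ∣ ball u (suc j) ∣) (+-comm (suc j) 1)
      (≤-trans (+-mono-≤ size (∑∈-≥ (∈-｛｝⁺ w)))
               (∑∈-disjoint (λ x∈B x∈｛w｝ → w∉B (subst (_∈ ball u j) (∈-｛｝⁻ x∈｛w｝) x∈B))
                            (ball-⊆-suc j)
                            (λ x∈｛w｝ → ∈-∪⁺ (inj₂ (subst (_∈ N[ ball u j ]) (sym (∈-｛｝⁻ x∈｛w｝))
                                                           (∈-N[]⁺ v∈B vw)))))))

    ∃-closed-ball : ∃[ J ] Closed (ball u J)
    ∃-closed-ball with closed-or-growing n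
    ... | inj₁ closed = closed
    ... | inj₂ size   = ⊥-elim (<⇒≱ size (∣∣≤n (ball u n)))

  deg : Fin n → ℕ
  deg v = ∣ adj G v ∣

  module _ (α : Colouring n) where

    minS maxS : Fin n → ℕ
    minS v = minL (spectrumList G α v)
    maxS v = maxL (spectrumList G α v)

    colour∈spectrum : Adj G v w → α v w ∈ₗ spectrumList G α v
    colour∈spectrum {v} {w} vw = ∈-map⁺ (α v) (∈-filter⁺ (T? ∘ adj G v) (∈-allFin w) vw)

    minS-≤ : Adj G v w → minS v ≤ α v w
    minS-≤ = minL-≤ ∘ colour∈spectrum

    ≤-maxS : Adj G v w → α v w ≤ maxS v
    ≤-maxS = ≤-maxL ∘ colour∈spectrum

    length-spectrum : (v : Fin n) → length (spectrumList G α v) ≡ deg v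
    length-spectrum v = trans (length-map (α v) (filterᵇ (adj G v) (allFin n)))
                              (length-filterᵇ-tabulate (adj G v) id)

    maxS-≤-minS+deg+def : Adj G v w → maxS v + 1 ≤ minS v + deg v + defV G α v
    maxS-≤-minS+deg+def {v} vw = subst (λ l → maxS v + 1 ≤ minS v + l + defV G α v)
      (length-spectrum v) (defSet-bound (colour∈spectrum vw))

    deficiency : VertexSet n → ℕ
    deficiency X = ∑∈ X (defV G α)

    Realised : VertexSet n → ℕ → Set
    Realised X k = ∃[ u ] ∃[ w ] (u ∈ X × Adj G u w × α u w ≡ k)

    module _ (proper : Proper G α) where

      colour-injective : Adj G v u → Adj G v w → α v u ≡ α v w → u ≡ w
      colour-injective {v} {u} {w} vu vw αvu≡αvw =
        decidable-stable (u ≟ᶠ w) λ u≢w → proj₂ proper v u w vu vw u≢w αvu≡αvw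

      -- The colours at v that are at most c = α v u are distinct and at least minS v, so there
      -- are at most c + 1 − minS v of them.
      maxS-≤ : Adj G v u → maxS v ≤ α v u + ∣ adj G v ∩ above (α v) (α v u) ∣ + defV G α v
      maxS-≤ {v} {u} vu = +-cancelʳ-≤ 1 _ _ (begin
        maxS v + 1                                ≤⟨ maxS-≤-minS+deg+def vu ⟩
        a + ∣ adj G v ∣ + d                       ≤⟨ +-monoˡ-≤ d (+-monoʳ-≤ a (∑∈-cover split)) ⟩
        a + (A + ∣ adj G v ∩ below (α v) (a + k) ∣) + d
                                             ≤⟨ +-monoˡ-≤ d (+-monoʳ-≤ a (+-monoʳ-≤ A window)) ⟩
        a + (A + k) + d                           ≡⟨ rearrange a A k d ⟩
        (a + k) + A + d                           ≡⟨ cong (λ x → x + A + d) a+k≡1+c ⟩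
        suc c + A + d                             ≡⟨ +-comm 1 (c + A + d) ⟩
        c + A + d + 1                             ∎)
        where
        open ≤-Reasoning
        c a d k A : ℕ
        c = α v u
        a = minS v
        d = defV G α v
        k = suc c ∸ a
        A = ∣ adj G v ∩ above (α v) c ∣

        a+k≡1+c : a + k ≡ suc c
        a+k≡1+c = m+[n∸m]≡n (m≤n⇒m≤1+n (minS-≤ vu))

        rearrange : ∀ a A k d → a + (A + k) + d ≡ (a + k) + A + d
        rearrange = solve-∀

        split : adj G v ⊆ adj G v ∩ above (α v) c ∪ adj G v ∩ below (α v) (a + k)
        split {w} w∈N with c <? α v w
        ... | yes c<αvw = ∈-∪⁺ (inj₁ (∈-∩⁺ w∈N (∈-⟦⟧⁺ c<αvw)))
        ... | no  c≮αvw = ∈-∪⁺ (inj₂ (∈-∩⁺ w∈N (∈-⟦⟧⁺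
                            (subst (α v w <_) (sym a+k≡1+c) (s≤s (≮⇒≥ c≮αvw))))))

        window : ∣ adj G v ∩ below (α v) (a + k) ∣ ≤ k
        window = ∣∩below∣-≤ (α v) (λ w∈N → minS-≤ (T-∈ w∈N))
                   (λ u∈N w∈N → colour-injective (T-∈ u∈N) (T-∈ w∈N)) k

      module _ (triangle-free : TriangleFree G) where

        module _ {u z : Fin n} (uz : Adj G u z) where

          BallBound : ℕ → Set
          BallBound j = ∀ {v} → v ∈ ball u j →
            maxS v + 2 ≤ minS u + ∣ ball u j ∪ adj G v ∣ + deficiency (ball u j)

          ball-bound-centre : BallBound 0
          ball-bound-centre v∈｛u｝ rewrite ∈-｛｝⁻ v∈｛u｝ = begin
            maxS u + 2                               ≡⟨ +-assoc (maxS u) 1 1 ⟨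
            maxS u + 1 + 1                           ≤⟨ +-monoˡ-≤ 1 (maxS-≤-minS+deg+def uz) ⟩
            minS u + deg u + defV G α u + 1          ≡⟨ rearrange (minS u) (deg u) (defV G α u) ⟩
            minS u + (1 + deg u) + defV G α u        ≤⟨ +-mono-≤
                                                          (+-monoʳ-≤ (minS u) centre+neighbours)
                                                          (∑∈-≥ (∈-｛｝⁺ u)) ⟩
            minS u + ∣ ｛ u ｝ ∪ adj G u ∣ + deficiency ｛ u ｝ ∎
            where
            open ≤-Reasoning
            rearrange : ∀ a b d → a + b + d + 1 ≡ a + (1 + b) + d
            rearrange = solve-∀

            centre+neighbours : 1 + deg u ≤ ∣ ｛ u ｝ ∪ adj G u ∣
            centre+neighbours = ≤-trans (+-monoˡ-≤ (deg u) (∑∈-≥ (∈-｛｝⁺ u)))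
              (∑∈-disjoint (λ w∈｛u｝ w∈N → subst T (irrefl G u)
                              (subst (λ x → T (adj G u x)) (∈-｛｝⁻ w∈｛u｝) (T-∈ w∈N)))
                           (∈-∪⁺ ∘ inj₁) (∈-∪⁺ ∘ inj₂))

          ball-bound-entering : ∀ {j} → BallBound j → ∀ {v} → v ∉ ball u j → v ∈ ball u (suc j) →
            maxS v + 2 ≤ minS u + ∣ ball u (suc j) ∪ adj G v ∣ + deficiency (ball u (suc j))
          ball-bound-entering {j} bound {v} v∉B v∈B′ = begin
            maxS v + 2                        ≤⟨ +-monoˡ-≤ 2 (maxS-≤ vm) ⟩
            c + A + d + 2                     ≤⟨ +-monoˡ-≤ 2 (+-monoˡ-≤ d
                                                   (+-mono-≤ c≤maxS-m (∑∈-mono-⊆ above-leaves))) ⟩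
            maxS m + A′ + d + 2               ≡⟨ rearrange₁ (maxS m) A′ d ⟩
            maxS m + 2 + A′ + d               ≤⟨ +-monoˡ-≤ d (+-monoˡ-≤ A′ (bound m∈B)) ⟩
            minS u + S + D + A′ + d           ≡⟨ rearrange₂ (minS u) S D A′ d ⟩
            minS u + (S + A′) + (D + d)       ≤⟨ +-mono-≤ (+-monoʳ-≤ (minS u) neighbourhoods)
                                                             deficiencies ⟩
            minS u + ∣ B′ ∪ adj G v ∣ + deficiency B′ ∎
            where
            open ≤-Reasoning
            B B′ : VertexSet n
            B  = ball u j
            B′ = ball u (suc j)

            entry : ∃[ x ] (x ∈ B × Adj G x v)
            entry with ∈-∪⁻ v∈B′
            ... | inj₁ v∈B = ⊥-elim (v∉B v∈B)
            ... | inj₂ v∈N = ∈-N[]⁻ v∈N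

            maximiser : ∃[ m ] (m ∈ B ∩ adj G v × (∀ {w} → w ∈ B ∩ adj G v → α v w ≤ α v m))
            maximiser = let x , x∈B , xv = entry in
              ∃-maximiser (α v) (∈-∩⁺ x∈B (mk∈ (subst T (Graph.sym G x v) xv)))

            m : Fin n
            m = proj₁ maximiser

            m∈B : m ∈ B
            m∈B = proj₁ (∈-∩⁻ (proj₁ (proj₂ maximiser)))

            vm : Adj G v m
            vm = T-∈ (proj₂ (∈-∩⁻ (proj₁ (proj₂ maximiser))))

            mv : Adj G m v
            mv = subst T (Graph.sym G v m) vm

            c d S D A A′ : ℕ
            c  = α v m
            d  = defV G α v
            S  = ∣ B ∪ adj G m ∣
            D  = deficiency B
            A  = ∣ adj G v ∩ above (α v) c ∣
            A′ = ∣ adj G v ∩ ∁ B ∣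

            c≤maxS-m : c ≤ maxS m
            c≤maxS-m = subst (_≤ maxS m) (sym (proj₁ proper v m vm)) (≤-maxS mv)

            above-leaves : adj G v ∩ above (α v) c ⊆ adj G v ∩ ∁ B
            above-leaves w∈ with ∈-∩⁻ w∈
            ... | w∈N , c<αvw = ∈-∩⁺ w∈N (∈-∁⁺ λ w∈B →
                  <⇒≱ (∈-⟦⟧⁻ c<αvw) (proj₂ (proj₂ maximiser) (∈-∩⁺ w∈B w∈N)))

            neighbourhoods : S + A′ ≤ ∣ B′ ∪ adj G v ∣
            neighbourhoods = ∑∈-disjoint apart inside (λ w∈ → ∈-∪⁺ (inj₂ (proj₁ (∈-∩⁻ w∈))))
              where
              apart : ∀ {w} → w ∈ B ∪ adj G m → w ∉ adj G v ∩ ∁ B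
              apart w∈ w∈′ with ∈-∪⁻ w∈ | ∈-∩⁻ w∈′
              ... | inj₁ w∈B  | _ , w∈∁B = ∈-∁⁻ w∈∁B w∈B
              ... | inj₂ w∈Nm | w∈N , _  = triangle-free m v _ (mv , T-∈ w∈N , T-∈ w∈Nm)

              inside : B ∪ adj G m ⊆ B′ ∪ adj G v
              inside w∈ with ∈-∪⁻ w∈
              ... | inj₁ w∈B  = ∈-∪⁺ (inj₁ (ball-⊆-suc j w∈B))
              ... | inj₂ w∈Nm = ∈-∪⁺ (inj₁ (∈-∪⁺ (inj₂ (∈-N[]⁺ m∈B (T-∈ w∈Nm)))))

            deficiencies : D + d ≤ deficiency B′
            deficiencies = ≤-trans (+-monoʳ-≤ D (∑∈-≥ (∈-｛｝⁺ v)))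
              (∑∈-disjoint (λ w∈B w∈｛v｝ → v∉B (subst (_∈ B) (∈-｛｝⁻ w∈｛v｝) w∈B))
                           (ball-⊆-suc j)
                           (λ w∈｛v｝ → subst (_∈ B′) (sym (∈-｛｝⁻ w∈｛v｝)) v∈B′))

            rearrange₁ : ∀ b a d → b + a + d + 2 ≡ b + 2 + a + d
            rearrange₁ = solve-∀

            rearrange₂ : ∀ a s x y z → a + s + x + y + z ≡ a + (s + y) + (x + z)
            rearrange₂ = solve-∀

          ball-bound : ∀ j → BallBound j
          ball-bound zero = ball-bound-centre
          ball-bound (suc j) {v} v∈B′ with ∈? {X = ball u j} {v}
          ... | no  v∉B = ball-bound-entering {j} (ball-bound j) v∉B v∈B′
          ... | yes v∈B = ≤-trans (ball-bound j v∈B)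
            (+-mono-≤ (+-monoʳ-≤ (minS u) (∑∈-mono-⊆ grow)) (∑∈-mono-⊆ (ball-⊆-suc j)))
            where
            grow : ball u j ∪ adj G v ⊆ ball u (suc j) ∪ adj G v
            grow w∈ = ∈-∪⁺ (Data.Sum.map₁ (ball-⊆-suc j) (∈-∪⁻ w∈))

          component : ∀ {X} → Closed X → u ∈ X → ∃[ K ] (u ∈ K × K ⊆ X × Closed K ×
                        ∀ {v} → v ∈ K → maxS v + 2 ≤ α u z + ∣ K ∣ + deficiency K)
          component closed u∈X with ∃-closed-ball {u}
          ... | J , K-closed = ball u J , centre∈ball J , ball-⊆-closed closed u∈X J , K-closed ,
            λ v∈K → ≤-trans (ball-bound J v∈K) (+-monoˡ-≤ _ (+-mono-≤ (minS-≤ uz)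
              (∑∈-mono-⊆ λ w∈ → [ id , (λ w∈N → K-closed v∈K (T-∈ w∈N)) ]′ (∈-∪⁻ w∈))))

        interval-bound : ∀ {X s t} → Closed X → s ≤ t → (∀ {k} → s ≤ k → k ≤ t → Realised X k) →
                         t + 2 ≤ s + ∣ X ∣ + deficiency X
        interval-bound {X} = bounded ∣ X ∣ ≤-refl
          where
          bounded : ∀ N {X s t} → ∣ X ∣ ≤ N → Closed X → s ≤ t →
                    (∀ {k} → s ≤ k → k ≤ t → Realised X k) → t + 2 ≤ s + ∣ X ∣ + deficiency X
          bounded N size closed s≤t realised with realised ≤-refl s≤t
          bounded zero    size _ _ _ | u , _ , u∈X , _ = ⊥-elim (<⇒≱ (∑∈-≥ u∈X) size)
          bounded (suc N) {X} {t = t} size closed s≤t realised | u , w , u∈X , uw , refl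
            with component uw closed u∈X
          ... | K , u∈K , K⊆X , K-closed , K-bound with ∃-maximiser maxS u∈K
          ... | m , m∈K , maximal with t ≤? maxS m
          ... | yes t≤b = begin
            t + 2                                ≤⟨ +-monoˡ-≤ 2 t≤b ⟩
            maxS m + 2                           ≤⟨ K-bound m∈K ⟩
            α u w + ∣ K ∣ + deficiency K         ≤⟨ +-mono-≤ (+-monoʳ-≤ (α u w) (∑∈-mono-⊆ K⊆X))
                                                             (∑∈-mono-⊆ K⊆X) ⟩
            α u w + ∣ X ∣ + deficiency X         ∎
            where open ≤-Reasoning
          ... | no  t≰b = join-interval-bounds
            (bounded N size′ (∩∁-closed closed K-closed) (≰⇒> t≰b) realised′)
            (K-bound m∈K) (∑∈-split-∁ K⊆X) (∑∈-split-∁ K⊆X)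
            where
            b : ℕ
            b = maxS m

            realised′ : ∀ {k} → suc b ≤ k → k ≤ t → Realised (X ∩ ∁ K) k
            realised′ b<k k≤t
              with realised (≤-trans (≤-maxS uw) (≤-trans (maximal u∈K) (<⇒≤ b<k))) k≤t
            ... | u′ , w′ , u′∈X , u′w′ , refl = u′ , w′ ,
              ∈-∩⁺ u′∈X (∈-∁⁺ λ u′∈K → <⇒≱ b<k (≤-trans (≤-maxS u′w′) (maximal u′∈K))) , u′w′ , refl

            size′ : ∣ X ∩ ∁ K ∣ ≤ N
            size′ = ≤-pred (≤-trans (+-monoˡ-≤ _ (∑∈-≥ u∈K)) (≤-trans (∑∈-split-∁ K⊆X) size))

-- The bound t ≤ n + def(G, α) − 1 holds for every proper t-edge-colouring α.
corollary2p1 : ∀ (n : ℕ) (G : Graph n) → TriangleFree G →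
    ∀ (t : ℕ) (α : Colouring n) → ProperTColouring G t α → AttainsDef G α →
    t ≤ (n + defG G α) ∸ 1
corollary2p1 n G triangle-free zero      α _                          _ = z≤n
corollary2p1 n G triangle-free t@(suc _) α (proper , _ , surjective) _ =
  m+n≤o⇒m≤o∸n t (≤-pred (begin
    suc (t + 1)                                ≡⟨ +-suc t 1 ⟨
    t + 2                                      ≤⟨ interval-bound G α proper triangle-free
                                                    (λ _ _ → ∈-full) (s≤s z≤n) realised ⟩
    1 + ∣ full {n} ∣ + deficiency G α full     ≡⟨ cong₂ (λ x y → 1 + x + y)
                                                    (∑-1 n) (sym (sum-map-tabulate (defV G α) id)) ⟩
    1 + n + defG G α                           ∎))
  where
  open ≤-Reasoning
  realised : ∀ {k} → 1 ≤ k → k ≤ t → Realised G α full k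
  realised 1≤k k≤t = let u , v , uv , αuv≡k = surjective _ 1≤k k≤t in u , v , ∈-full , uv , αuv≡k
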